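{- Let $r\in\mathbb N$, let $G$ be an abelian group, and let $\mathcal A=(A_1,\dots,A_q)$ where for each $i$, $A_i=a_i+M_i$ with $a_i\in G$ and $M_i\subseteq G$ a submonoid (i.e. $0\in M_i$ and $M_i+M_i\subseteq M_i$). Then for every $\mathbf h=(h_1,\dots,h_q)\in\mathbb N_0^q$, \[ (r\mathbf h)\cdot\mathcal A=(r-1)\sum_{i=1}^q h_ia_i+\mathbf h\cdot\mathcal A. \] Consequently $\mathcal A$ is a chromatic $(r,1)$-approximate group.
   Context: $\mathbb N=\{1,2,\dots\}$, $\mathbb N_0=\{0,1,2,\dots\}$. For subsets $X,Y$ of an abelian group, $X+Y=\{x+y:x\in X,y\in Y\}$, and $x+Y=\{x\}+Y$; for $h\in\mathbb N$, $hA$ is the $h$-fold sumset $A+\cdots+A$ and $0A=\{0\}$. For $\mathbf h=(h_1,\dots,h_q)\in\mathbb N_0^q$, $\mathbf h\cdot\mathcal A=h_1A_1+\cdots+h_qA_q$ and $r\mathbf h=(rh_1,\dots,rh_q)$. A tuple $\mathcal A$ is a chromatic $(r,\ell)$-approximate group if for every $\mathbf h\in\mathbb N_0^q$ there is $X_{\mathbf h}\subseteq G$ with $|X_{\mathbf h}|\le\ell$ and $(r\mathbf h)\cdot\mathcal A\subseteq X_{\mathbf h}+\mathbf h\cdot\mathcal A$. -}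

module Defs where

open import Level using (Level; _⊔_)
open import Algebra.Bundles using (AbelianGroup)
open import Data.Nat using (ℕ; zero; suc; _*_; _≤_)
open import Data.Fin using (Fin; zero; suc)
open import Data.List using (List; length)
open import Data.List.Relation.Unary.Any using (Any)
open import Data.Product using (Σ; _×_; ∃)
open import Relation.Unary using (Pred)

module Sumsets {c ℓ : Level} (G : AbelianGroup c ℓ) (p : Level) where
  open AbelianGroup G

  L : Level
  L = c ⊔ ℓ ⊔ p

  Subset : Set (Level.suc L)
  Subset = Pred Carrier L

  _⊆_ : Subset → Subset → Set L
  X ⊆ Y = ∀ {x} → X x → Y x

  _≐_ : Subset → Subset → Set L
  X ≐ Y = (X ⊆ Y) × (Y ⊆ X)

  ｛_｝ : Carrier → Subset
  ｛ g ｝ x = Level.Lift L (x ≈ g)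

  _⊕_ : Subset → Subset → Subset
  (X ⊕ Y) z = Σ Carrier λ x → Σ Carrier λ y → X x × Y y × (z ≈ x ∙ y)

  _+ˢ_ : Carrier → Subset → Subset
  g +ˢ Y = ｛ g ｝ ⊕ Y

  _·ˢ_ : ℕ → Subset → Subset
  zero  ·ˢ A = ｛ ε ｝
  suc h ·ˢ A = A ⊕ (h ·ˢ A)

  _×ᵍ_ : ℕ → Carrier → Carrier
  zero  ×ᵍ g = ε
  suc n ×ᵍ g = g ∙ (n ×ᵍ g)

  ∑ : (q : ℕ) → (Fin q → Carrier) → Carrier
  ∑ zero    f = ε
  ∑ (suc q) f = f zero ∙ ∑ q (λ i → f (suc i))

  _⊙_ : {q : ℕ} → (Fin q → ℕ) → (Fin q → Subset) → Subset
  _⊙_ {zero}  h 𝒜 = ｛ ε ｝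
  _⊙_ {suc q} h 𝒜 = (h zero ·ˢ 𝒜 zero) ⊕ ((λ i → h (suc i)) ⊙ (λ i → 𝒜 (suc i)))

  scale : {q : ℕ} → ℕ → (Fin q → ℕ) → (Fin q → ℕ)
  scale r h i = r * h i

  record IsSubmonoid (M : Pred Carrier p) : Set (c ⊔ p) where
    field
      has-ε : M ε
      closed : ∀ {x y} → M x → M y → M (x ∙ y)

  coset : Carrier → Pred Carrier p → Subset
  coset a M x = Σ Carrier λ m → M m × (x ≈ a ∙ m)

  listSet : List Carrier → Subset
  listSet xs x = Level.Lift L (Any (x ≈_) xs)

  -- chromatic (r,ℓ')-approximate group: for every 𝐡 there is a set X_𝐡 with
  -- at most ℓ' elements (a set listed by a list of length ≤ ℓ') such that
  -- (r𝐡)·𝒜 ⊆ X_𝐡 + 𝐡·𝒜.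
  ChromaticApproxGroup : {q : ℕ} → ℕ → ℕ → (Fin q → Subset) → Set L
  ChromaticApproxGroup {q} r ℓ' 𝒜 =
    (h : Fin q → ℕ) → Σ (List Carrier) λ xs →
      (length xs ≤ ℓ') × ((scale r h ⊙ 𝒜) ⊆ (listSet xs ⊕ (h ⊙ 𝒜)))

{-# OPTIONS --safe #-}
module Submission where

-- Each Aᵢ is the translate aᵢ + ⟨Mᵢ⟩ of the ≈-closure ⟨M⟩ = coset ε M, and translates pull out
-- of sumsets, so 𝐡·𝒜 = (∑ hᵢaᵢ) + 𝐡·⟨𝓜⟩.  A submonoid satisfies k⟨M⟩ = ⟨M⟩ for every k ≥ 1, so
-- replacing 𝐡 by r𝐡 leaves 𝐡·⟨𝓜⟩ unchanged and only multiplies the translate by r.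

open import Defs
open import Level using (Level; lift)
open import Algebra.Bundles using (AbelianGroup)
open import Data.Nat using (ℕ; _≤_; _∸_; zero; suc; _+_; _*_; s≤s; z≤n)
open import Data.Nat.Properties using (*-zeroʳ)
open import Data.Fin using (Fin; zero; suc)
open import Data.List using (_∷_; [])
open import Data.List.Relation.Unary.Any using (here)
open import Data.Product using (_×_; _,_; Σ; proj₁)
open import Relation.Unary using (Pred)
open import Relation.Unary.Properties using (≐-refl; ≐-sym; ≐-trans)
open import Relation.Binary.Bundles using (Setoid)
open import Relation.Binary.Definitions using (_Respects_)
open import Relation.Binary.PropositionalEquality using (_≡_; cong; cong₂)
  renaming (refl to ≡-refl; trans to ≡-trans)
import Algebra.Properties.CommutativeMonoid.Mult as Mult
import Algebra.Properties.CommutativeMonoid.Sum as Sum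
import Algebra.Properties.CommutativeSemigroup as CommutativeSemigroupProperties
import Relation.Binary.Reasoning.Setoid as SetoidReasoning

module SumsetProperties {c ℓ : Level} (G : AbelianGroup c ℓ) (p : Level) where
  open AbelianGroup G
  open Sumsets G p
  open CommutativeSemigroupProperties commutativeSemigroup using (interchange)
  open Mult commutativeMonoid using (×-homo-+; ×-assocˡ) renaming (_×_ to _·_)
  open Sum commutativeMonoid using (sum; sum-cong-≋; sum-cong-≗; sum-replicate-zero; ∑-distrib-+)

  ×ᵍ≡· : ∀ n x → n ×ᵍ x ≡ n · x
  ×ᵍ≡· zero    x = ≡-refl
  ×ᵍ≡· (suc n) x = cong (x ∙_) (×ᵍ≡· n x)

  ∑≡sum : ∀ q (f : Fin q → Carrier) → ∑ q f ≡ sum f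
  ∑≡sum zero    f = ≡-refl
  ∑≡sum (suc q) f = cong (f zero ∙_) (∑≡sum q (λ i → f (suc i)))

  ∑-×ᵍ≡sum-· : ∀ q (n : Fin q → ℕ) (a : Fin q → Carrier) →
               ∑ q (λ i → n i ×ᵍ a i) ≡ sum (λ i → n i · a i)
  ∑-×ᵍ≡sum-· q n a = ≡-trans (∑≡sum q _) (sum-cong-≗ (λ i → ×ᵍ≡· (n i) (a i)))

  ·-sum : ∀ n {q} (f : Fin q → Carrier) → n · sum f ≈ sum (λ i → n · f i)
  ·-sum zero    {q} f = sym (sum-replicate-zero q)
  ·-sum (suc n)     f = trans (∙-congˡ (·-sum n f)) (sym (∑-distrib-+ f _))

  ∑-suc*-×ᵍ : ∀ r q (h : Fin q → ℕ) (a : Fin q → Carrier) →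
    ∑ q (λ i → (suc r * h i) ×ᵍ a i)
      ≈ (r ×ᵍ ∑ q (λ i → h i ×ᵍ a i)) ∙ ∑ q (λ i → h i ×ᵍ a i)
  ∑-suc*-×ᵍ r q h a = begin
    ∑ q (λ i → (suc r * h i) ×ᵍ a i) ≡⟨ ∑-×ᵍ≡sum-· q (λ i → suc r * h i) a ⟩
    sum (λ i → (suc r * h i) · a i)  ≈⟨ sum-cong-≋ (λ i → split (h i) (a i)) ⟩
    sum (λ i → hᵢaᵢ i ∙ r · hᵢaᵢ i)   ≈⟨ ∑-distrib-+ hᵢaᵢ (λ i → r · hᵢaᵢ i) ⟩
    sum hᵢaᵢ ∙ sum (λ i → r · hᵢaᵢ i) ≈⟨ ∙-congˡ (sym (·-sum r hᵢaᵢ)) ⟩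
    sum hᵢaᵢ ∙ r · sum hᵢaᵢ           ≈⟨ comm _ _ ⟩
    r · sum hᵢaᵢ ∙ sum hᵢaᵢ           ≡⟨ cong₂ _∙_ (≡-trans (×ᵍ≡· r s) (cong (r ·_) s≡)) s≡ ⟨
    (r ×ᵍ s) ∙ s                     ∎
    where
    open SetoidReasoning setoid
    hᵢaᵢ : Fin q → Carrier
    hᵢaᵢ i = h i · a i
    s : Carrier
    s = ∑ q (λ i → h i ×ᵍ a i)
    s≡ : s ≡ sum hᵢaᵢ
    s≡ = ∑-×ᵍ≡sum-· q h a
    split : ∀ k x → (suc r * k) · x ≈ k · x ∙ r · (k · x)
    split k x = trans (×-homo-+ x k (r * k)) (∙-congˡ (sym (×-assocˡ x r k)))

  ≐-setoid : Setoid (Level.suc L) L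
  ≐-setoid = record
    { Carrier       = Subset
    ; _≈_           = _≐_
    ; isEquivalence = record { refl = ≐-refl ; sym = ≐-sym ; trans = ≐-trans }
    }

  +ˢ-intro : ∀ {X g y z} → X y → z ≈ g ∙ y → (g +ˢ X) z
  +ˢ-intro {g = g} {y} y∈X z≈g∙y = g , y , lift refl , y∈X , z≈g∙y

  +ˢ-elim : ∀ {X g z} → (g +ˢ X) z → Σ Carrier λ y → X y × z ≈ g ∙ y
  +ˢ-elim (_ , y , lift x≈g , y∈X , z≈x∙y) = y , y∈X , trans z≈x∙y (∙-congʳ x≈g)

  ｛｝-resp : ∀ g → ｛ g ｝ Respects _≈_
  ｛｝-resp g x≈y (lift x≈g) = lift (trans (sym x≈y) x≈g)

  ⊕-cong : ∀ {X X′ Y Y′} → X ≐ X′ → Y ≐ Y′ → (X ⊕ Y) ≐ (X′ ⊕ Y′)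
  ⊕-cong (X⊆X′ , X′⊆X) (Y⊆Y′ , Y′⊆Y) =
    (λ (x , y , x∈X , y∈Y , e) → x , y , X⊆X′ x∈X , Y⊆Y′ y∈Y , e) ,
    (λ (x , y , x∈X′ , y∈Y′ , e) → x , y , X′⊆X x∈X′ , Y′⊆Y y∈Y′ , e)

  ⊕-identityˡ : ∀ {X} → X Respects _≈_ → (｛ ε ｝ ⊕ X) ≐ X
  ⊕-identityˡ X-resp =
    (λ z∈ → let (y , y∈X , z≈ε∙y) = +ˢ-elim z∈ in X-resp (sym (trans z≈ε∙y (identityˡ y))) y∈X) ,
    (λ {z} z∈X → +ˢ-intro z∈X (sym (identityˡ z)))

  ⊕-identityʳ : ∀ {X} → X Respects _≈_ → (X ⊕ ｛ ε ｝) ≐ X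
  ⊕-identityʳ X-resp =
    (λ (x , y , x∈X , lift y≈ε , z≈x∙y) →
      X-resp (sym (trans z≈x∙y (trans (∙-congˡ y≈ε) (identityʳ x)))) x∈X) ,
    (λ {z} z∈X → z , ε , z∈X , lift refl , sym (identityʳ z))

  +ˢ-cong : ∀ {g g′ X Y} → g ≈ g′ → X ≐ Y → (g +ˢ X) ≐ (g′ +ˢ Y)
  +ˢ-cong g≈g′ (X⊆Y , Y⊆X) =
    (λ z∈ → let (y , y∈X , e) = +ˢ-elim z∈ in +ˢ-intro (X⊆Y y∈X) (trans e (∙-congʳ g≈g′))) ,
    (λ z∈ → let (y , y∈Y , e) = +ˢ-elim z∈ in +ˢ-intro (Y⊆X y∈Y) (trans e (∙-congʳ (sym g≈g′))))

  +ˢ-assoc : ∀ {g g′ X} → (g +ˢ (g′ +ˢ X)) ≐ ((g ∙ g′) +ˢ X)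
  +ˢ-assoc {g} {g′} =
    (λ z∈ → let (w , w∈ , z≈g∙w) = +ˢ-elim z∈ ; (y , y∈X , w≈g′∙y) = +ˢ-elim w∈ in
      +ˢ-intro y∈X (trans z≈g∙w (trans (∙-congˡ w≈g′∙y) (sym (assoc g g′ y))))) ,
    (λ z∈ → let (y , y∈X , e) = +ˢ-elim z∈ in
      +ˢ-intro (+ˢ-intro y∈X refl) (trans e (assoc g g′ y)))

  +ˢ-⊕-+ˢ : ∀ {g g′ X Y} → ((g +ˢ X) ⊕ (g′ +ˢ Y)) ≐ ((g ∙ g′) +ˢ (X ⊕ Y))
  +ˢ-⊕-+ˢ {g} {g′} =
    (λ (u , v , u∈ , v∈ , z≈u∙v) →
      let (x , x∈X , u≈g∙x) = +ˢ-elim u∈ ; (y , y∈Y , v≈g′∙y) = +ˢ-elim v∈ in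
      +ˢ-intro (x , y , x∈X , y∈Y , refl)
        (trans z≈u∙v (trans (∙-cong u≈g∙x v≈g′∙y) (interchange g x g′ y)))) ,
    (λ z∈ → let (w , (x , y , x∈X , y∈Y , w≈x∙y) , z≈gg′∙w) = +ˢ-elim z∈ in
      g ∙ x , g′ ∙ y , +ˢ-intro x∈X refl , +ˢ-intro y∈Y refl ,
      trans z≈gg′∙w (trans (∙-congˡ w≈x∙y) (interchange g g′ x y)))

  ·ˢ-cong : ∀ k {X Y} → X ≐ Y → (k ·ˢ X) ≐ (k ·ˢ Y)
  ·ˢ-cong zero    X≐Y = ≐-refl
  ·ˢ-cong (suc k) X≐Y = ⊕-cong X≐Y (·ˢ-cong k X≐Y)

  ·ˢ-+ˢ : ∀ k {g X} → (k ·ˢ (g +ˢ X)) ≐ ((k ×ᵍ g) +ˢ (k ·ˢ X))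
  ·ˢ-+ˢ zero    = ≐-sym (⊕-identityˡ (｛｝-resp ε))
  ·ˢ-+ˢ (suc k) = ≐-trans (⊕-cong ≐-refl (·ˢ-+ˢ k)) +ˢ-⊕-+ˢ

  ⊙-cong : ∀ {q} (h h′ : Fin q → ℕ) (𝒜 ℬ : Fin q → Subset) →
           (∀ i → (h i ·ˢ 𝒜 i) ≐ (h′ i ·ˢ ℬ i)) → (h ⊙ 𝒜) ≐ (h′ ⊙ ℬ)
  ⊙-cong {zero}  h h′ 𝒜 ℬ hᵢ𝒜ᵢ≐ = ≐-refl
  ⊙-cong {suc q} h h′ 𝒜 ℬ hᵢ𝒜ᵢ≐ = ⊕-cong (hᵢ𝒜ᵢ≐ zero)
    (⊙-cong (λ i → h (suc i)) (λ i → h′ (suc i)) (λ i → 𝒜 (suc i)) (λ i → ℬ (suc i))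
            (λ i → hᵢ𝒜ᵢ≐ (suc i)))

  ⊙-+ˢ : ∀ {q} (h : Fin q → ℕ) (a : Fin q → Carrier) (𝒮 : Fin q → Subset) →
         (h ⊙ (λ i → a i +ˢ 𝒮 i)) ≐ (∑ q (λ i → h i ×ᵍ a i) +ˢ (h ⊙ 𝒮))
  ⊙-+ˢ {zero}  h a 𝒮 = ≐-sym (⊕-identityˡ (｛｝-resp ε))
  ⊙-+ˢ {suc q} h a 𝒮 = ≐-trans
    (⊕-cong (·ˢ-+ˢ (h zero)) (⊙-+ˢ (λ i → h (suc i)) (λ i → a (suc i)) (λ i → 𝒮 (suc i))))
    +ˢ-⊕-+ˢ

  module _ {S : Subset} (S-resp : S Respects _≈_) (ε∈S : S ε)
           (∙-closed : ∀ {x y} → S x → S y → S (x ∙ y)) where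

    ·ˢ-suc-submonoid : ∀ k → (suc k ·ˢ S) ≐ S
    ·ˢ-suc-submonoid zero    = ⊕-identityʳ S-resp
    ·ˢ-suc-submonoid (suc k) = ≐-trans (⊕-cong ≐-refl (·ˢ-suc-submonoid k)) S⊕S≐S
      where
      S⊕S≐S : (S ⊕ S) ≐ S
      S⊕S≐S = (λ (x , y , x∈S , y∈S , z≈x∙y) → S-resp (sym z≈x∙y) (∙-closed x∈S y∈S)) ,
              (λ {z} z∈S → z , ε , z∈S , ε∈S , sym (identityʳ z))

    ·ˢ-suc*-submonoid : ∀ m k → ((suc m * k) ·ˢ S) ≐ (k ·ˢ S)
    ·ˢ-suc*-submonoid m zero rewrite *-zeroʳ m = ≐-refl
    ·ˢ-suc*-submonoid m (suc k) =
      ≐-trans (·ˢ-suc-submonoid (k + m * suc k)) (≐-sym (·ˢ-suc-submonoid k))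

  coset≐+ˢcoset-ε : ∀ a (M : Pred Carrier p) → coset a M ≐ (a +ˢ coset ε M)
  coset≐+ˢcoset-ε a M =
    (λ (m , m∈M , x≈a∙m) → +ˢ-intro (m , m∈M , sym (identityˡ m)) x≈a∙m) ,
    (λ x∈ → let (y , (m , m∈M , y≈ε∙m) , x≈a∙y) = +ˢ-elim x∈ in
      m , m∈M , trans x≈a∙y (∙-congˡ (trans y≈ε∙m (identityˡ m))))

  coset-ε-resp : ∀ M → coset ε M Respects _≈_
  coset-ε-resp M x≈y (m , m∈M , x≈ε∙m) = m , m∈M , trans (sym x≈y) x≈ε∙m

  ·ˢ-suc*-coset-ε : ∀ {M} → IsSubmonoid M → ∀ m k →
                    ((suc m * k) ·ˢ coset ε M) ≐ (k ·ˢ coset ε M)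
  ·ˢ-suc*-coset-ε {M} M-submonoid = ·ˢ-suc*-submonoid (coset-ε-resp M) ε∈ ∙-closed
    where
    open IsSubmonoid M-submonoid
    ε∈ : coset ε M ε
    ε∈ = ε , has-ε , sym (identityʳ ε)
    ∙-closed : ∀ {x y} → coset ε M x → coset ε M y → coset ε M (x ∙ y)
    ∙-closed (m , m∈M , x≈ε∙m) (n , n∈M , y≈ε∙n) = m ∙ n , closed m∈M n∈M ,
      trans (∙-cong (trans x≈ε∙m (identityˡ m)) (trans y≈ε∙n (identityˡ n))) (sym (identityˡ _))

  ⊙-coset : ∀ {q} (h : Fin q → ℕ) (a : Fin q → Carrier) (M : Fin q → Pred Carrier p) →
            (h ⊙ (λ i → coset (a i) (M i)))
              ≐ (∑ q (λ i → h i ×ᵍ a i) +ˢ (h ⊙ (λ i → coset ε (M i))))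
  ⊙-coset h a M = ≐-trans
    (⊙-cong h h _ _ (λ i → ·ˢ-cong (h i) (coset≐+ˢcoset-ε (a i) (M i))))
    (⊙-+ˢ h a _)

  scale-suc-⊙-coset : ∀ r {q} (a : Fin q → Carrier) (M : Fin q → Pred Carrier p) →
    (∀ i → IsSubmonoid (M i)) → ∀ h →
    (scale (suc r) h ⊙ (λ i → coset (a i) (M i)))
      ≐ ((r ×ᵍ ∑ q (λ i → h i ×ᵍ a i)) +ˢ (h ⊙ (λ i → coset (a i) (M i))))
  scale-suc-⊙-coset r {q} a M M-submonoid h = begin
    scale (suc r) h ⊙ 𝒜                                         ≈⟨ ⊙-coset (scale (suc r) h) a M ⟩
    ∑ q (λ i → (suc r * h i) ×ᵍ a i) +ˢ (scale (suc r) h ⊙ ⟨𝓜⟩) ≈⟨ +ˢ-cong (∑-suc*-×ᵍ r q h a) r𝐡⟨𝓜⟩≐𝐡⟨𝓜⟩ ⟩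
    ((r ×ᵍ s) ∙ s) +ˢ (h ⊙ ⟨𝓜⟩)                                  ≈⟨ +ˢ-assoc ⟨
    (r ×ᵍ s) +ˢ (s +ˢ (h ⊙ ⟨𝓜⟩))                                 ≈⟨ +ˢ-cong refl (⊙-coset h a M) ⟨
    (r ×ᵍ s) +ˢ (h ⊙ 𝒜)                                         ∎
    where
    open SetoidReasoning ≐-setoid
    𝒜 ⟨𝓜⟩ : Fin q → Subset
    𝒜 i = coset (a i) (M i)
    ⟨𝓜⟩ i = coset ε (M i)
    s : Carrier
    s = ∑ q (λ i → h i ×ᵍ a i)
    r𝐡⟨𝓜⟩≐𝐡⟨𝓜⟩ : (scale (suc r) h ⊙ ⟨𝓜⟩) ≐ (h ⊙ ⟨𝓜⟩)
    r𝐡⟨𝓜⟩≐𝐡⟨𝓜⟩ = ⊙-cong _ h ⟨𝓜⟩ ⟨𝓜⟩ (λ i → ·ˢ-suc*-coset-ε (M-submonoid i) r (h i))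

  translates⇒ChromaticApproxGroup₁ : ∀ {q} r (𝒜 : Fin q → Subset) →
    (∀ h → Σ Carrier λ g → (scale r h ⊙ 𝒜) ⊆ (g +ˢ (h ⊙ 𝒜))) → ChromaticApproxGroup r 1 𝒜
  translates⇒ChromaticApproxGroup₁ r 𝒜 translate h =
    let (g , ⊆g+) = translate h in
    g ∷ [] , s≤s z≤n ,
    λ z∈ → let (x , y , lift x≈g , y∈ , z≈x∙y) = ⊆g+ z∈ in x , y , lift (here x≈g) , y∈ , z≈x∙y

theorem1p13 : {c ℓ p : Level} (G : AbelianGroup c ℓ) (r : ℕ) → 1 ≤ r →
    (q : ℕ) (a : Fin q → AbelianGroup.Carrier G) (M : Fin q → Pred (AbelianGroup.Carrier G) p) →
    ((i : Fin q) → Sumsets.IsSubmonoid G p (M i)) →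
    ((h : Fin q → ℕ) →
      Sumsets._≐_ G p
        (Sumsets._⊙_ G p (Sumsets.scale G p r h) (λ i → Sumsets.coset G p (a i) (M i)))
        (Sumsets._+ˢ_ G p
          (Sumsets._×ᵍ_ G p (r ∸ 1) (Sumsets.∑ G p q (λ i → Sumsets._×ᵍ_ G p (h i) (a i))))
          (Sumsets._⊙_ G p h (λ i → Sumsets.coset G p (a i) (M i)))))
    × Sumsets.ChromaticApproxGroup G p r 1 (λ i → Sumsets.coset G p (a i) (M i))
theorem1p13 {p = p} G (suc r) (s≤s z≤n) q a M M-submonoid =
  scale-suc-⊙-coset r a M M-submonoid ,
  translates⇒ChromaticApproxGroup₁ (suc r) _
    (λ h → _ , proj₁ (scale-suc-⊙-coset r a M M-submonoid h))
  where open SumsetProperties G p
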